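{- Let $N = p^k m^2$ be an odd perfect number given in Eulerian form satisfying $m^2 - p^k = 40$. Then $m < p^k$.
   Context: A positive integer $N$ is an odd perfect number if $N$ is odd and $\sigma(N) = 2N$, where $\sigma$ denotes the sum-of-divisors function. An odd perfect number is said to be given in Eulerian form $N = p^k m^2$ if $p$ is a prime (the special prime), $k$ and $m$ are positive integers, $p \equiv k \equiv 1 \pmod 4$, and $\gcd(p,m) = 1$. -}

module Defs where

open import Data.Nat using (ℕ; suc; _+_; _*_; _^_; _%_; _<_)
open import Data.Nat.Divisibility using (_∣_; _∣?_)
open import Data.Nat.Primality using (Prime)
open import Data.Nat.Coprimality using (Coprime)
open import Data.List using (List; upTo; filter; map)
open import Data.Nat.ListAction using (sum)
open import Data.Product using (_×_)
open import Relation.Binary.PropositionalEquality using (_≡_)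

divisors : ℕ → List ℕ
divisors n = filter (_∣? n) (map suc (upTo n))

σ : ℕ → ℕ
σ n = sum (divisors n)

OddPerfect : ℕ → Set
OddPerfect N = (N % 2 ≡ 1) × (σ N ≡ 2 * N)

EulerianForm : ℕ → ℕ → ℕ → ℕ → Set
EulerianForm N p k m =
  OddPerfect N × (N ≡ p ^ k * (m * m)) × Prime p ×
  (p % 4 ≡ 1) × (k % 4 ≡ 1) × (0 < m) × Coprime p m

{-# OPTIONS --safe #-}
module Submission where

open import Defs
open import Data.Nat using (ℕ; _+_; _*_; _^_; _<_; _≤_; _≰_; suc; s≤s; z≤n; z<s; _≤?_)
open import Data.Nat.Properties
open import Relation.Nullary using (yes; no; contradiction)
open import Relation.Binary.PropositionalEquality using (_≡_; refl; trans)

-- For m ≥ 7, m * m ≥ 7 * m > m + 40 ≥ n + 40; for m ≤ 6, m * m < 40.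
m*m≡40+n⇒n≰m : ∀ m n → m * m ≡ 40 + n → n ≰ m
m*m≡40+n⇒n≰m 0 n ()
m*m≡40+n⇒n≰m 1 n ()
m*m≡40+n⇒n≰m 2 n ()
m*m≡40+n⇒n≰m 3 n ()
m*m≡40+n⇒n≰m 4 n ()
m*m≡40+n⇒n≰m 5 n ()
m*m≡40+n⇒n≰m 6 n ()
m*m≡40+n⇒n≰m m@(suc (suc (suc (suc (suc (suc (suc _))))))) n eq n≤m =
  <-irrefl refl (begin-strict
    m + 40     <⟨ +-monoʳ-< m (m<n+m 40 {2} z<s) ⟩
    m + 42     ≤⟨ +-monoʳ-≤ m (*-monoʳ-≤ 6 7≤m) ⟩
    7 * m      ≤⟨ *-monoˡ-≤ m 7≤m ⟩
    m * m      ≡⟨ eq ⟩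
    40 + n     ≤⟨ +-monoʳ-≤ 40 n≤m ⟩
    40 + m     ≡⟨ +-comm 40 m ⟩
    m + 40     ∎)
  where
  open ≤-Reasoning
  7≤m : 7 ≤ m
  7≤m = s≤s (s≤s (s≤s (s≤s (s≤s (s≤s (s≤s z≤n))))))

m*m≡n+40⇒m<n : ∀ m n → m * m ≡ n + 40 → m < n
m*m≡n+40⇒m<n m n eq with suc m ≤? n
... | yes m<n = m<n
... | no m≮n = contradiction (≮⇒≥ m≮n) (m*m≡40+n⇒n≰m m n (trans eq (+-comm n 40)))

lemma3 : (N p k m : ℕ) → EulerianForm N p k m →
         m * m ≡ p ^ k + 40 → m < p ^ k
lemma3 N p k m _ = m*m≡n+40⇒m<n m (p ^ k)
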